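{- Let $\Sigma$ be a nonempty finite set, $\mu$ a sub-additive measure over $\Sigma$, and $0<\rho<1$. Then there exists $\Lambda_1\subseteq\Sigma$ such that for every $\tilde\Lambda\subseteq\Lambda_1$ it holds that $\mu(\tilde\Lambda)\geq\rho\cdot\frac{|\tilde\Lambda|}{|\Sigma|}\cdot\mu(\Sigma)$, and $\mu(\Lambda_1)\geq(1-\rho)\cdot\mu(\Sigma)$.
   Context: A sub-additive measure over a nonempty finite set $\Sigma$ is a function $\mu:2^\Sigma\to\mathbb{N}$ with $\mu(\emptyset)=0$, $\mu(\Lambda)\geq1$ for every nonempty $\Lambda\subseteq\Sigma$, and $\mu(\Lambda\cup\Lambda')\leq\mu(\Lambda)+\mu(\Lambda')$ for all $\Lambda,\Lambda'\subseteq\Sigma$.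
   Formalization: The parameter ρ ranges over the rationals in the open interval between 0 and 1. -}

module Defs where

open import Data.Nat using (ℕ; suc; _≤_; _+_)
open import Data.Fin.Subset using (Subset; ⊥; _∪_; Nonempty)
open import Relation.Binary.PropositionalEquality using (_≡_)
open import Data.Product using (_×_)

record SubAdditiveMeasure (n : ℕ) : Set where
  field
    μ          : Subset n → ℕ
    μ-empty    : μ ⊥ ≡ 0
    μ-nonempty : ∀ (Λ : Subset n) → Nonempty Λ → 1 ≤ μ Λ
    μ-subadd   : ∀ (Λ Λ′ : Subset n) → μ (Λ ∪ Λ′) ≤ μ Λ + μ Λ′

{-# OPTIONS --safe #-}
module Submission where

-- Write ρ = p/q and N = |Σ|.  Let B minimise the potential
-- qN·μ(Λ) + pμ(Σ)·|Σ ∖ Λ| and put Λ₁ = Σ ∖ B.  For L ⊆ Λ₁, minimality against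
-- B ∪ L and subadditivity give pμ(Σ)·|L| ≤ qN·μ(L), the density bound.
-- Minimality against ∅ gives qN·μ(B) ≤ pμ(Σ)·N, i.e. μ(B) ≤ ρμ(Σ), and then
-- μ(Σ) ≤ μ(B) + μ(Λ₁) gives μ(Λ₁) ≥ (1 - ρ)μ(Σ).  All of this is done in ℕ
-- with the denominators cleared, and transferred to ℚ at the end.

open import Defs
open import Data.Vec using ([]; _∷_; here)
open import Data.Nat as ℕ using (ℕ; zero; suc)
import Data.Nat.Properties as ℕ
open import Algebra.Properties.CommutativeSemigroup ℕ.+-commutativeSemigroup
  using (xy∙z≈xz∙y)
open import Algebra.Properties.CommutativeSemigroup ℕ.*-commutativeSemigroup
  using () renaming (xy∙z≈xz∙y to *-right-comm)
open import Data.Integer as ℤ using (+_; -[1+_]; +≤+)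
import Data.Integer.Properties as ℤ
open import Data.Fin.Subset using (Subset; inside; outside; ⊥; ⊤; ∁; _∪_; _⊆_; ∣_∣)
open import Data.Fin.Subset.Properties using (drop-∷-⊆; p∪∁p≡⊤; ∣∁p∣≡n∸∣p∣; ∣⊥∣≡0)
open import Data.Product using (Σ; Σ-syntax; _×_; _,_; proj₁; proj₂)
open import Function using (_∘_)
open import Relation.Nullary using (yes; no)
open import Relation.Binary.PropositionalEquality
  using (_≡_; refl; sym; trans; cong; cong₂; subst; subst₂)

minimiser : ∀ n (f : Subset n → ℕ) → Σ[ B ∈ Subset n ] (∀ Λ → f B ℕ.≤ f Λ)
minimiser zero    f = [] , λ { [] → ℕ.≤-refl }
minimiser (suc n) f with minimiser n (f ∘ (inside ∷_)) | minimiser n (f ∘ (outside ∷_))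
... | B₁ , min₁ | B₀ , min₀ with f (inside ∷ B₁) ℕ.≤? f (outside ∷ B₀)
...   | yes f₁≤f₀ = inside ∷ B₁ , λ where
        (inside  ∷ Λ) → min₁ Λ
        (outside ∷ Λ) → ℕ.≤-trans f₁≤f₀ (min₀ Λ)
...   | no  f₁≰f₀ = outside ∷ B₀ , λ where
        (inside  ∷ Λ) → ℕ.≤-trans (ℕ.≰⇒≥ f₁≰f₀) (min₁ Λ)
        (outside ∷ Λ) → min₀ Λ

q⊆∁p⇒∣∁p∣≡∣∁[p∪q]∣+∣q∣ : ∀ {n} (p q : Subset n) → q ⊆ ∁ p → ∣ ∁ p ∣ ≡ ∣ ∁ (p ∪ q) ∣ ℕ.+ ∣ q ∣
q⊆∁p⇒∣∁p∣≡∣∁[p∪q]∣+∣q∣ []            []            _    = refl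
q⊆∁p⇒∣∁p∣≡∣∁[p∪q]∣+∣q∣ (inside  ∷ p) (inside  ∷ q) q⊆∁p with () ← q⊆∁p here
q⊆∁p⇒∣∁p∣≡∣∁[p∪q]∣+∣q∣ (inside  ∷ p) (outside ∷ q) q⊆∁p =
  q⊆∁p⇒∣∁p∣≡∣∁[p∪q]∣+∣q∣ p q (drop-∷-⊆ q⊆∁p)
q⊆∁p⇒∣∁p∣≡∣∁[p∪q]∣+∣q∣ (outside ∷ p) (inside  ∷ q) q⊆∁p =
  trans (cong suc (q⊆∁p⇒∣∁p∣≡∣∁[p∪q]∣+∣q∣ p q (drop-∷-⊆ q⊆∁p))) (sym (ℕ.+-suc _ _))
q⊆∁p⇒∣∁p∣≡∣∁[p∪q]∣+∣q∣ (outside ∷ p) (outside ∷ q) q⊆∁p =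
  cong suc (q⊆∁p⇒∣∁p∣≡∣∁[p∪q]∣+∣q∣ p q (drop-∷-⊆ q⊆∁p))

module _ {n} (M : SubAdditiveMeasure n) where
  open SubAdditiveMeasure M
  open import Data.Nat using (_+_; _*_; _∸_)

  μ⊤≤μp+μ∁p : ∀ p → μ ⊤ ℕ.≤ μ p + μ (∁ p)
  μ⊤≤μp+μ∁p p = subst (λ Λ → μ Λ ℕ.≤ μ p + μ (∁ p)) (p∪∁p≡⊤ p) (μ-subadd p (∁ p))

  module _ (K c : ℕ) where

    potential : Subset n → ℕ
    potential Λ = K * μ Λ + c * ∣ ∁ Λ ∣

    IsMinimal : Subset n → Set
    IsMinimal B = ∀ Λ → potential B ℕ.≤ potential Λ

    minimal⇒dense : ∀ {B} → IsMinimal B → ∀ L → L ⊆ ∁ B → c * ∣ L ∣ ℕ.≤ K * μ L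
    minimal⇒dense {B} minimal L L⊆∁B = ℕ.+-cancelˡ-≤ (K * μ B + c * a) _ _ (begin
      K * μ B + c * a + c * ∣ L ∣   ≡⟨ ℕ.+-assoc (K * μ B) (c * a) (c * ∣ L ∣) ⟩
      K * μ B + (c * a + c * ∣ L ∣) ≡⟨ cong (λ k → K * μ B + k) (ℕ.*-distribˡ-+ c a ∣ L ∣) ⟨
      K * μ B + c * (a + ∣ L ∣)     ≡⟨ cong (λ k → K * μ B + c * k) ∣∁B∣≡a+∣L∣ ⟨
      potential B                   ≤⟨ minimal (B ∪ L) ⟩
      K * μ (B ∪ L) + c * a         ≤⟨ ℕ.+-monoˡ-≤ (c * a) (ℕ.*-monoʳ-≤ K (μ-subadd B L)) ⟩
      K * (μ B + μ L) + c * a       ≡⟨ cong (_+ c * a) (ℕ.*-distribˡ-+ K (μ B) (μ L)) ⟩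
      K * μ B + K * μ L + c * a     ≡⟨ xy∙z≈xz∙y (K * μ B) (K * μ L) (c * a) ⟩
      K * μ B + c * a + K * μ L     ∎)
      where
      open ℕ.≤-Reasoning
      a = ∣ ∁ (B ∪ L) ∣
      ∣∁B∣≡a+∣L∣ = q⊆∁p⇒∣∁p∣≡∣∁[p∪q]∣+∣q∣ B L L⊆∁B

    minimal⇒light : ∀ {B} → IsMinimal B → K * μ B ℕ.≤ c * n
    minimal⇒light {B} minimal = begin
      K * μ B                       ≤⟨ ℕ.m≤m+n (K * μ B) (c * ∣ ∁ B ∣) ⟩
      potential B                   ≤⟨ minimal ⊥ ⟩
      K * μ ⊥ + c * ∣ ∁ (⊥ {n}) ∣   ≡⟨ cong₂ (λ x y → K * x + c * y) μ-empty ∣∁⊥∣≡n ⟩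
      K * 0 + c * n                 ≡⟨ cong (_+ c * n) (ℕ.*-zeroʳ K) ⟩
      c * n                         ∎
      where
      open ℕ.≤-Reasoning
      ∣∁⊥∣≡n : ∣ ∁ (⊥ {n}) ∣ ≡ n
      ∣∁⊥∣≡n = trans (∣∁p∣≡n∸∣p∣ (⊥ {n})) (cong (n ∸_) (∣⊥∣≡0 n))

open import Data.Rational
  using (ℚ; mkℚ; _/_; _*_; _+_; _-_; -_; _≤_; _<_; 0ℚ; 1ℚ; toℚᵘ; *≤*)
open import Data.Rational.Properties
  using (toℚᵘ-fromℚᵘ; toℚᵘ-cancel-≤; toℚᵘ-injective; toℚᵘ-homo-*; toℚᵘ-homo-+;
         normalize-coprime; *-distribʳ-+; *-identityˡ; neg-distribˡ-*; +-monoˡ-≤;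
         +-monoʳ-≤; neg-antimono-≤; +-comm; +-assoc; +-inverseʳ; +-identityʳ; <⇒≤;
         module ≤-Reasoning)
open import Data.Rational.Unnormalised as ℚᵘ using (mkℚᵘ) renaming (_≃_ to _≃ᵘ_)
import Data.Rational.Unnormalised.Properties as ℚᵘ

toℚᵘ-/ : ∀ i n → toℚᵘ (i / suc n) ≃ᵘ mkℚᵘ i n
toℚᵘ-/ i n = toℚᵘ-fromℚᵘ (mkℚᵘ i n)

/-mono-≤ : ∀ a b m n → a ℕ.* suc n ℕ.≤ b ℕ.* suc m → (+ a) / suc m ≤ (+ b) / suc n
/-mono-≤ a b m n a*n≤b*m = toℚᵘ-cancel-≤
  (ℚᵘ.≤-respˡ-≃ (ℚᵘ.≃-sym (toℚᵘ-/ (+ a) m)) (ℚᵘ.≤-respʳ-≃ (ℚᵘ.≃-sym (toℚᵘ-/ (+ b) n))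
    (ℚᵘ.*≤* (subst₂ ℤ._≤_ (ℤ.pos-* a (suc n)) (ℤ.pos-* b (suc m)) (+≤+ a*n≤b*m)))))

/-* : ∀ a b m n → (+ a) / suc m * ((+ b) / suc n) ≡ (+ (a ℕ.* b)) / (suc m ℕ.* suc n)
/-* a b m n = toℚᵘ-injective (begin
  toℚᵘ ((+ a) / suc m * ((+ b) / suc n))          ≈⟨ toℚᵘ-homo-* ((+ a) / suc m) ((+ b) / suc n) ⟩
  toℚᵘ ((+ a) / suc m) ℚᵘ.* toℚᵘ ((+ b) / suc n) ≈⟨ ℚᵘ.*-cong (toℚᵘ-/ (+ a) m) (toℚᵘ-/ (+ b) n) ⟩
  mkℚᵘ (+ a) m ℚᵘ.* mkℚᵘ (+ b) n                  ≡⟨ cong (λ i → mkℚᵘ i d) (ℤ.pos-* a b) ⟨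
  mkℚᵘ (+ (a ℕ.* b)) d                             ≈⟨ toℚᵘ-/ (+ (a ℕ.* b)) d ⟨
  toℚᵘ ((+ (a ℕ.* b)) / (suc m ℕ.* suc n))        ∎)
  where
  open ℚᵘ.≃-Reasoning
  d = n ℕ.+ m ℕ.* suc n

/-+ : ∀ a b m n →
      (+ a) / suc m + (+ b) / suc n ≡ (+ (a ℕ.* suc n ℕ.+ b ℕ.* suc m)) / (suc m ℕ.* suc n)
/-+ a b m n = toℚᵘ-injective (begin
  toℚᵘ ((+ a) / suc m + (+ b) / suc n)            ≈⟨ toℚᵘ-homo-+ ((+ a) / suc m) ((+ b) / suc n) ⟩
  toℚᵘ ((+ a) / suc m) ℚᵘ.+ toℚᵘ ((+ b) / suc n) ≈⟨ ℚᵘ.+-cong (toℚᵘ-/ (+ a) m) (toℚᵘ-/ (+ b) n) ⟩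
  mkℚᵘ (+ a) m ℚᵘ.+ mkℚᵘ (+ b) n                  ≡⟨ cong (λ i → mkℚᵘ i d) numerator ⟨
  mkℚᵘ (+ (a ℕ.* suc n ℕ.+ b ℕ.* suc m)) d         ≈⟨ toℚᵘ-/ (+ (a ℕ.* suc n ℕ.+ b ℕ.* suc m)) d ⟨
  toℚᵘ ((+ (a ℕ.* suc n ℕ.+ b ℕ.* suc m)) / (suc m ℕ.* suc n)) ∎)
  where
  open ℚᵘ.≃-Reasoning
  d = n ℕ.+ m ℕ.* suc n
  numerator : + (a ℕ.* suc n ℕ.+ b ℕ.* suc m) ≡ + a ℤ.* + suc n ℤ.+ + b ℤ.* + suc m
  numerator = trans (ℤ.pos-+ (a ℕ.* suc n) (b ℕ.* suc m))
                    (cong₂ ℤ._+_ (ℤ.pos-* a (suc n)) (ℤ.pos-* b (suc m)))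

/1-+ : ∀ a b → (+ a) / 1 + (+ b) / 1 ≡ (+ (a ℕ.+ b)) / 1
/1-+ a b = trans (/-+ a b 0 0) (cong (λ k → (+ k) / 1) (cong₂ ℕ._+_ (ℕ.*-identityʳ a) (ℕ.*-identityʳ b)))

/1-mono-≤ : ∀ {a b} → a ℕ.≤ b → (+ a) / 1 ≤ (+ b) / 1
/1-mono-≤ {a} {b} a≤b =
  /-mono-≤ a b 0 0 (subst₂ ℕ._≤_ (sym (ℕ.*-identityʳ a)) (sym (ℕ.*-identityʳ b)) a≤b)

p*b*a≤q*n*c⇒p/q*[a/n]*b≤c : ∀ p d a m b c → p ℕ.* b ℕ.* a ℕ.≤ suc d ℕ.* suc m ℕ.* c →
                             (+ p) / suc d * ((+ a) / suc m) * ((+ b) / 1) ≤ (+ c) / 1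
p*b*a≤q*n*c⇒p/q*[a/n]*b≤c p d a m b c p*b*a≤q*n*c = begin
  (+ p) / q * ((+ a) / n) * ((+ b) / 1) ≡⟨ cong (_* ((+ b) / 1)) (/-* p a d m) ⟩
  (+ (p ℕ.* a)) / (q ℕ.* n) * ((+ b) / 1) ≡⟨ /-* (p ℕ.* a) b (m ℕ.+ d ℕ.* n) 0 ⟩
  (+ (p ℕ.* a ℕ.* b)) / (q ℕ.* n ℕ.* 1)   ≤⟨ /-mono-≤ (p ℕ.* a ℕ.* b) c ((m ℕ.+ d ℕ.* n) ℕ.* 1) 0 cross ⟩
  (+ c) / 1                                ∎
  where
  q = suc d
  n = suc m
  cross : p ℕ.* a ℕ.* b ℕ.* 1 ℕ.≤ c ℕ.* (q ℕ.* n ℕ.* 1)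
  cross = begin
    p ℕ.* a ℕ.* b ℕ.* 1  ≡⟨ ℕ.*-identityʳ _ ⟩
    p ℕ.* a ℕ.* b        ≡⟨ *-right-comm p a b ⟩
    p ℕ.* b ℕ.* a        ≤⟨ p*b*a≤q*n*c ⟩
    q ℕ.* n ℕ.* c        ≡⟨ ℕ.*-comm (q ℕ.* n) c ⟩
    c ℕ.* (q ℕ.* n)      ≡⟨ cong (c ℕ.*_) (ℕ.*-identityʳ (q ℕ.* n)) ⟨
    c ℕ.* (q ℕ.* n ℕ.* 1) ∎
    where open ℕ.≤-Reasoning
  open ≤-Reasoning

q*a≤p*b⇒a≤p/q*b : ∀ p d a b → suc d ℕ.* a ℕ.≤ p ℕ.* b → (+ a) / 1 ≤ (+ p) / suc d * ((+ b) / 1)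
q*a≤p*b⇒a≤p/q*b p d a b q*a≤p*b =
  subst ((+ a) / 1 ≤_) (sym (/-* p b d 0)) (/-mono-≤ a (p ℕ.* b) 0 (d ℕ.* 1) cross)
  where
  open ℕ.≤-Reasoning
  cross : a ℕ.* (suc d ℕ.* 1) ℕ.≤ p ℕ.* b ℕ.* 1
  cross = begin
    a ℕ.* (suc d ℕ.* 1) ≡⟨ cong (a ℕ.*_) (ℕ.*-identityʳ (suc d)) ⟩
    a ℕ.* suc d         ≡⟨ ℕ.*-comm a (suc d) ⟩
    suc d ℕ.* a         ≤⟨ q*a≤p*b ⟩
    p ℕ.* b             ≡⟨ ℕ.*-identityʳ (p ℕ.* b) ⟨
    p ℕ.* b ℕ.* 1       ∎

0≤ρ⇒ρ≡p/q : ∀ {ρ} → 0ℚ ≤ ρ → Σ[ p ∈ ℕ ] Σ[ d ∈ ℕ ] ρ ≡ (+ p) / suc d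
0≤ρ⇒ρ≡p/q {mkℚ (+ p)      d coprime} _ = p , d , sym (normalize-coprime coprime)
0≤ρ⇒ρ≡p/q {mkℚ -[1+ _ ] _ _}         (*≤* ())

t≤b+a⇒b≤ρ*t⇒[1-ρ]*t≤a : ∀ {ρ t b a} → t ≤ b + a → b ≤ ρ * t → (1ℚ - ρ) * t ≤ a
t≤b+a⇒b≤ρ*t⇒[1-ρ]*t≤a {ρ} {t} {b} {a} t≤b+a b≤ρ*t = begin
  (1ℚ - ρ) * t        ≡⟨ *-distribʳ-+ t 1ℚ (- ρ) ⟩
  1ℚ * t + - ρ * t    ≡⟨ cong₂ _+_ (*-identityˡ t) (sym (neg-distribˡ-* ρ t)) ⟩
  t - ρ * t           ≤⟨ +-monoˡ-≤ (- (ρ * t)) t≤b+a ⟩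
  b + a - ρ * t       ≤⟨ +-monoʳ-≤ (b + a) (neg-antimono-≤ b≤ρ*t) ⟩
  b + a - b           ≡⟨ cong (_- b) (+-comm b a) ⟩
  a + b - b           ≡⟨ +-assoc a b (- b) ⟩
  a + (b - b)         ≡⟨ cong (λ x → a + x) (+-inverseʳ b) ⟩
  a + 0ℚ              ≡⟨ +-identityʳ a ⟩
  a                   ∎
  where open ≤-Reasoning

propositionA1 : (m : ℕ) (M : SubAdditiveMeasure (suc m)) (ρ : ℚ) →
    0ℚ < ρ → ρ < 1ℚ →
    let open SubAdditiveMeasure M in
    Σ (Subset (suc m)) λ Λ₁ →
      ((Λ~ : Subset (suc m)) → Λ~ ⊆ Λ₁ →
        ρ * ((+ ∣ Λ~ ∣) / suc m) * ((+ μ ⊤) / 1) ≤ (+ μ Λ~) / 1)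
      × ((1ℚ - ρ) * ((+ μ ⊤) / 1) ≤ (+ μ Λ₁) / 1)
propositionA1 m M ρ 0<ρ _ with 0≤ρ⇒ρ≡p/q (<⇒≤ 0<ρ)
... | p , d , refl = ∁ B , dense , heavy
  where
  open SubAdditiveMeasure M
  N = suc m
  q = suc d
  K = q ℕ.* N
  c = p ℕ.* μ ⊤
  B = proj₁ (minimiser N (potential M K c))
  minimal = proj₂ (minimiser N (potential M K c))

  dense : ∀ L → L ⊆ ∁ B → (+ p) / q * ((+ ∣ L ∣) / N) * ((+ μ ⊤) / 1) ≤ (+ μ L) / 1
  dense L L⊆∁B = p*b*a≤q*n*c⇒p/q*[a/n]*b≤c p d ∣ L ∣ m (μ ⊤) (μ L)
    (minimal⇒dense M K c minimal L L⊆∁B)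

  light : q ℕ.* μ B ℕ.≤ p ℕ.* μ ⊤
  light = ℕ.*-cancelʳ-≤ (q ℕ.* μ B) c N
    (subst (ℕ._≤ c ℕ.* N) (sym (*-right-comm q (μ B) N)) (minimal⇒light M K c minimal))

  heavy : (1ℚ - (+ p) / q) * ((+ μ ⊤) / 1) ≤ (+ μ (∁ B)) / 1
  heavy = t≤b+a⇒b≤ρ*t⇒[1-ρ]*t≤a {ρ = (+ p) / q}
    (subst ((+ μ ⊤) / 1 ≤_) (sym (/1-+ (μ B) (μ (∁ B)))) (/1-mono-≤ (μ⊤≤μp+μ∁p M B)))
    (q*a≤p*b⇒a≤p/q*b p d (μ B) (μ ⊤) light)
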